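{- Every Godsil graph is a Tinhofer graph.
   Context: Graphs are finite simple undirected vertex-colored graphs ($c:V(G)\to\{1,\dots,k\}$); isomorphisms and automorphisms preserve colors. A partition of $V(G)$ is equitable if each cell is monochromatic, each cell induces a regular graph, and for any two cells $X,Y$ every vertex of $X$ has the same number of neighbors in $Y$. For a subgroup $\Gamma\le\mathrm{Aut}(G)$, the partition of $V(G)$ into $\Gamma$-orbits is an orbit partition. $G$ is a Godsil graph if every equitable partition of $G$ is an orbit partition of some subgroup of $\mathrm{Aut}(G)$. Color refinement (CR): $C^0(u)=c(u)$, $C^{i+1}(u)=(C^i(u),\{\!\{C^i(a): a\in N(u)\}\!\})$. Tinhofer's algorithm on input $(G,H)$: (1) run CR on the disjoint union $G+H$ until the coloring stabilizes; (2) if the multisets of colors in $G$ and $H$ differ, output "non-isomorphic"; otherwise (a) if all color classes are singletons, output "isomorphic" if the map matching each $u\in V(G)$ to the vertex of $H$ of the same color is an isomorphism, else "non-isomorphic"; (b) otherwise pick a color class with at least two vertices in each of $G$ and $H$, choose arbitrary $u\in V(G)$, $v\in V(H)$ in it, assign both the same new color, and go to (1). $G$ is a Tinhofer graph if for every graph $H$ and all choices in step (b) the algorithm correctly decides whether $G\cong H$. -}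

module Defs where

open import Data.Nat using (ℕ; zero; suc; _+_; _≤_; _≡ᵇ_)
open import Data.Bool using (Bool; true; false; _∧_; _∨_; not; if_then_else_)
open import Data.Fin using (Fin; zero; suc; _↑ˡ_; _↑ʳ_; splitAt)
open import Data.Fin.Properties using (_≟_)
open import Data.Sum using (_⊎_; inj₁; inj₂)
open import Data.Product using (Σ; _×_; ∃; _,_)
open import Data.Empty using (⊥)
open import Relation.Nullary using (¬_)
open import Relation.Nullary.Decidable using (⌊_⌋)
open import Relation.Binary.PropositionalEquality using (_≡_)
open import Level using (Level) renaming (suc to lsuc)

-- Finite simple undirected vertex-coloured graphs on vertex set Fin n.
-- Colours are natural numbers (any colouring into {1..k} is one).

record Graph : Set where
  field
    n      : ℕ
    adj    : Fin n → Fin n → Bool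
    adj-sym : ∀ x y → adj x y ≡ adj y x
    adj-irr : ∀ x → adj x x ≡ false
    col    : Fin n → ℕ
open Graph public

count : ∀ {N} → (Fin N → Bool) → ℕ
count {zero}  p = 0
count {suc N} p = (if p zero then 1 else 0) + count (λ i → p (suc i))

allFin : ∀ {N} → (Fin N → Bool) → Bool
allFin {zero}  p = true
allFin {suc N} p = p zero ∧ allFin (λ i → p (suc i))

eqFin : ∀ {N} → Fin N → Fin N → Bool
eqFin x y = ⌊ x ≟ y ⌋

IsIso : (G H : Graph) → (Fin (n G) → Fin (n H)) → Set
IsIso G H f =
  (Σ (Fin (n H) → Fin (n G)) λ g → (∀ x → g (f x) ≡ x) × (∀ y → f (g y) ≡ y))
  × (∀ a b → adj H (f a) (f b) ≡ adj G a b)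
  × (∀ a → col H (f a) ≡ col G a)

Iso : Graph → Graph → Set
Iso G H = Σ (Fin (n G) → Fin (n H)) (IsIso G H)

IsSubgroupAut : (G : Graph) → ((Fin (n G) → Fin (n G)) → Set) → Set
IsSubgroupAut G Γ =
  (∀ f → Γ f → IsIso G G f)
  × Γ (λ x → x)
  × (∀ f g → Γ f → Γ g → Γ (λ x → f (g x)))
  × (∀ f → Γ f → Σ (Fin (n G) → Fin (n G)) λ g → Γ g × (∀ x → g (f x) ≡ x))

-- Partitions of V(G), given by a cell-labelling P : V(G) → ℕ
-- (u, v lie in the same cell iff P u ≡ P v).

nbIn : (G : Graph) → (Fin (n G) → ℕ) → Fin (n G) → ℕ → ℕ
nbIn G P u i = count (λ x → adj G u x ∧ (P x ≡ᵇ i))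

-- cells monochromatic; every vertex of a cell X has the same number of
-- neighbours in any cell Y (Y = X gives regularity of the induced graph)
Equitable : (G : Graph) → (Fin (n G) → ℕ) → Set
Equitable G P =
  (∀ u v → P u ≡ P v → col G u ≡ col G v)
  × (∀ u v w → P u ≡ P v → nbIn G P u (P w) ≡ nbIn G P v (P w))

OrbitPartitionOf : (G : Graph) → ((Fin (n G) → Fin (n G)) → Set) → (Fin (n G) → ℕ) → Set
OrbitPartitionOf G Γ P =
  ∀ u v → (P u ≡ P v → Σ (Fin (n G) → Fin (n G)) λ f → Γ f × f u ≡ v)
        × ((Σ (Fin (n G) → Fin (n G)) λ f → Γ f × f u ≡ v) → P u ≡ P v)

Godsil : Graph → Set₁
Godsil G = ∀ (P : Fin (n G) → ℕ) → Equitable G P →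
  Σ ((Fin (n G) → Fin (n G)) → Set) λ Γ → IsSubgroupAut G Γ × OrbitPartitionOf G Γ P

-- A colouring is represented by its "same colour" relation E; by
-- definition of CR, the partition of C^{i+1} depends only on that of C^i:
-- C^{i+1}(u) = C^{i+1}(v) iff C^i(u) = C^i(v) and, for every C^i-class,
-- u and v have equally many neighbours in it (multiset equality).

Rel : ℕ → Set
Rel N = Fin N → Fin N → Bool

refine : ∀ {N} → Rel N → Rel N → Rel N
refine A E u v =
  E u v ∧ allFin (λ w → count (λ x → A u x ∧ E x w) ≡ᵇ count (λ x → A v x ∧ E x w))

sameRel : ∀ {N} → Rel N → Rel N → Bool
sameRel E F = allFin (λ u → allFin (λ v → not (E u v) ∨ F u v) ∧ allFin (λ v → not (F u v) ∨ E u v))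

-- iterate CR until the colouring stabilises (fuel N suffices: each
-- non-stable round strictly increases the number of classes, at most N)
iterCR : ∀ {N} → ℕ → Rel N → Rel N → Rel N
iterCR zero    A E = E
iterCR (suc f) A E = if sameRel (refine A E) E then E else iterCR f A (refine A E)

stableCR : ∀ {N} → Rel N → Rel N → Rel N
stableCR {N} A E = iterCR N A E

individualise : ∀ {N} → Rel N → Fin N → Fin N → Rel N
individualise E a b x y =
  let ix = eqFin x a ∨ eqFin x b
      iy = eqFin y a ∨ eqFin y b
  in (ix ∧ iy) ∨ (not ix ∧ not iy ∧ E x y)

module Union (G H : Graph) where
  N : ℕ
  N = n G + n H

  inG : Fin (n G) → Fin N
  inG u = u ↑ˡ n H

  inH : Fin (n H) → Fin N
  inH v = n G ↑ʳ v

  adjU : Rel N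
  adjU x y with splitAt (n G) x | splitAt (n G) y
  ... | inj₁ a | inj₁ b = adj G a b
  ... | inj₂ a | inj₂ b = adj H a b
  ... | _      | _      = false

  colU : Fin N → ℕ
  colU x with splitAt (n G) x
  ... | inj₁ a = col G a
  ... | inj₂ b = col H b

  initCol : Rel N
  initCol x y = colU x ≡ᵇ colU y

  cntG : Rel N → Fin N → ℕ
  cntG S w = count (λ u → S (inG u) w)

  cntH : Rel N → Fin N → ℕ
  cntH S w = count (λ v → S (inH v) w)

  SameMultiset : Rel N → Set
  SameMultiset S = ∀ w → cntG S w ≡ cntH S w

  Discrete : Rel N → Set
  Discrete S = ∀ u u' → S (inG u) (inG u') ≡ true → u ≡ u'

  MatchingIsIso : Rel N → Set
  MatchingIsIso S = Σ (Fin (n G) → Fin (n H)) λ f →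
    (∀ u → S (inG u) (inH (f u)) ≡ true) × IsIso G H f

  data Answer : Set where
    isomorphic nonIsomorphic : Answer

  -- Run E a : some execution of the algorithm started (at step (1)) with
  -- colouring E on G + H outputs a  (all choices in step (b) allowed)
  data Run (E : Rel N) : Answer → Set where
    diffMultiset : ¬ SameMultiset (stableCR adjU E) → Run E nonIsomorphic
    discreteYes  : SameMultiset (stableCR adjU E) → Discrete (stableCR adjU E) →
                   MatchingIsIso (stableCR adjU E) → Run E isomorphic
    discreteNo   : SameMultiset (stableCR adjU E) → Discrete (stableCR adjU E) →
                   ¬ MatchingIsIso (stableCR adjU E) → Run E nonIsomorphic
    individ      : ∀ {a} → SameMultiset (stableCR adjU E) → ¬ Discrete (stableCR adjU E) →
                   (u : Fin (n G)) (v : Fin (n H)) →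
                   stableCR adjU E (inG u) (inH v) ≡ true →
                   2 ≤ cntG (stableCR adjU E) (inG u) →
                   2 ≤ cntH (stableCR adjU E) (inG u) →
                   Run (individualise (stableCR adjU E) (inG u) (inH v)) a →
                   Run E a

  Correct : Answer → Set
  Correct isomorphic    = Iso G H
  Correct nonIsomorphic = ¬ Iso G H

Tinhofer : Graph → Set
Tinhofer G = ∀ (H : Graph) (a : Union.Answer G H) →
  Union.Run G H (Union.initCol G H) a → Union.Correct G H a

-- Call a colouring E of G + H (an equivalence relation on its
-- vertices) sound if it refines the initial colouring and, whenever G ≅ H, some
-- isomorphism f : G → H is aligned with E, i.e. gives each u the colour of f u.
-- The initial colouring is sound, and soundness is preserved by
--   * one round of colour refinement: f transports neighbour counts of u to f u;
--   * hence by running CR to its stable colouring S;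
--   * individualising u ∈ G, v ∈ H of equal S-colour: S restricted to G is equitable,
--     so by the Godsil property it is the orbit partition of a group of automorphisms;
--     u and f⁻¹ v have equal colour, so some automorphism σ maps u to f⁻¹ v, and
--     f ∘ σ is an aligned isomorphism mapping u to v, aligned with the new colouring.
-- Every run starting from a sound colouring answers correctly: "isomorphic" comes
-- with an explicit isomorphism, and both ways of answering "non-isomorphic" are
-- refuted by an aligned isomorphism.  Stability of the output of CR (needed for
-- equitability) holds because every non-stable round increases the number of
-- colour classes, of which there are at most |V(G + H)|.
module Submission where

open import Defs
open import Data.Nat using (ℕ; zero; suc; _+_; _≤_; _≡ᵇ_; z≤n; s≤s)
open import Data.Nat.Properties
  using (≤-refl; ≤-antisym; +-assoc; +-suc; +-identityʳ; +-mono-≤; +-monoˡ-≤;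
         m≤n+m; n≮n; ≡ᵇ⇒≡; ≡⇒≡ᵇ; +-0-commutativeMonoid)
open import Data.Bool using (Bool; true; false; _∧_; _∨_; not; if_then_else_; T)
open import Data.Bool.Properties using (∨-zeroʳ)
open import Data.Unit using (tt)
open import Data.Fin using (Fin; zero; suc; toℕ; _↑ˡ_; _↑ʳ_; splitAt)
open import Data.Fin.Properties
  using (toℕ-injective; _≟_; ↑ˡ-injective; ↑ʳ-injective; splitAt-↑ˡ; splitAt-↑ʳ)
open import Data.Fin.Permutation using (permutation)
open import Data.Sum using (_⊎_; inj₁; inj₂)
open import Data.Product using (Σ; _×_; _,_; proj₁; proj₂)
open import Data.Empty using (⊥-elim)
open import Relation.Nullary using (yes; no)
open import Relation.Binary.PropositionalEquality
  using (_≡_; _≢_; refl; sym; trans; cong; cong₂; subst; module ≡-Reasoning)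
import Algebra.Properties.CommutativeMonoid.Sum as CommutativeMonoidSum

∧-true : ∀ {a b} → a ∧ b ≡ true → a ≡ true × b ≡ true
∧-true {true} {true} _ = refl , refl

∧-false : ∀ {a b} → a ∧ b ≡ false → a ≡ false ⊎ b ≡ false
∧-false {false} _ = inj₁ refl
∧-false {true}  e = inj₂ e

∨-true : ∀ {a b} → a ∨ b ≡ true → a ≡ true ⊎ b ≡ true
∨-true {true}  _ = inj₁ refl
∨-true {false} e = inj₂ e

bool-ext : ∀ {a b} → (a ≡ true → b ≡ true) → (b ≡ true → a ≡ true) → a ≡ b
bool-ext {true}  {true}  _ _ = refl
bool-ext {false} {false} _ _ = refl
bool-ext {true}  {false} f _ = sym (f refl)
bool-ext {false} {true}  _ g = g refl

≡ᵇ-true : ∀ {m k} → (m ≡ᵇ k) ≡ true → m ≡ k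
≡ᵇ-true {m} {k} e = ≡ᵇ⇒≡ m k (subst T (sym e) tt)

≡ᵇ-intro : ∀ {m k} → m ≡ k → (m ≡ᵇ k) ≡ true
≡ᵇ-intro {m} {k} e with m ≡ᵇ k | ≡⇒≡ᵇ m k e
... | true  | _  = refl
... | false | ()

eqFin-true : ∀ {N} {x y : Fin N} → eqFin x y ≡ true → x ≡ y
eqFin-true {x = x} {y} e with x ≟ y
... | yes x≡y = x≡y

eqFin-refl : ∀ {N} (x : Fin N) → eqFin x x ≡ true
eqFin-refl x with x ≟ x
... | yes _  = refl
... | no x≢x = ⊥-elim (x≢x refl)

eqFin-≢ : ∀ {N} {x y : Fin N} → x ≢ y → eqFin x y ≡ false
eqFin-≢ {x = x} {y} x≢y with x ≟ y
... | yes x≡y = ⊥-elim (x≢y x≡y)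
... | no _    = refl

allFin-true : ∀ {N} (p : Fin N → Bool) → allFin p ≡ true → ∀ i → p i ≡ true
allFin-true p e zero    = proj₁ (∧-true e)
allFin-true p e (suc i) = allFin-true (λ j → p (suc j)) (proj₂ (∧-true {p zero} e)) i

allFin-intro : ∀ {N} (p : Fin N → Bool) → (∀ i → p i ≡ true) → allFin p ≡ true
allFin-intro {zero}  p h = refl
allFin-intro {suc N} p h rewrite h zero = allFin-intro (λ i → p (suc i)) (λ i → h (suc i))

allFin-false : ∀ {N} (p : Fin N → Bool) → allFin p ≡ false → Σ (Fin N) λ i → p i ≡ false
allFin-false {suc N} p e with ∧-false {p zero} e
... | inj₁ p0 = zero , p0
... | inj₂ ps with allFin-false (λ i → p (suc i)) ps
...   | i , pi = suc i , pi

ind : Bool → ℕ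
ind b = if b then 1 else 0

ind-mono : ∀ {a b} → (a ≡ true → b ≡ true) → ind a ≤ ind b
ind-mono {false} _ = z≤n
ind-mono {true}  h rewrite h refl = ≤-refl

count-cong : ∀ {N} (p q : Fin N → Bool) → (∀ i → p i ≡ q i) → count p ≡ count q
count-cong {zero}  p q h = refl
count-cong {suc N} p q h =
  cong₂ _+_ (cong ind (h zero)) (count-cong (λ i → p (suc i)) (λ i → q (suc i)) (λ i → h (suc i)))

count-none : ∀ {N} (p : Fin N → Bool) → (∀ i → p i ≡ false) → count p ≡ 0
count-none {zero}  p h = refl
count-none {suc N} p h rewrite h zero = count-none (λ i → p (suc i)) (λ i → h (suc i))

count-≤ : ∀ {N} (p : Fin N → Bool) → count p ≤ N
count-≤ {zero}  p = z≤n
count-≤ {suc N} p = +-mono-≤ (ind-mono {p zero} {true} (λ _ → refl)) (count-≤ (λ i → p (suc i)))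

count-mono : ∀ {N} (p q : Fin N → Bool) → (∀ i → p i ≡ true → q i ≡ true) → count p ≤ count q
count-mono {zero}  p q h = z≤n
count-mono {suc N} p q h =
  +-mono-≤ (ind-mono (h zero)) (count-mono (λ i → p (suc i)) (λ i → q (suc i)) (λ i → h (suc i)))

count-strict : ∀ {N} (p q : Fin N → Bool) → (∀ i → p i ≡ true → q i ≡ true) →
  (i : Fin N) → p i ≡ false → q i ≡ true → suc (count p) ≤ count q
count-strict p q h zero pi qi rewrite pi | qi =
  s≤s (count-mono (λ i → p (suc i)) (λ i → q (suc i)) (λ i → h (suc i)))
count-strict p q h (suc i) pi qi =
  subst (_≤ count q) (+-suc (ind (p zero)) _)
    (+-mono-≤ (ind-mono (h zero)) (count-strict (λ j → p (suc j)) (λ j → q (suc j)) (λ j → h (suc j)) i pi qi))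

count-split : ∀ a b (p : Fin (a + b) → Bool) →
  count p ≡ count (λ i → p (i ↑ˡ b)) + count (λ j → p (a ↑ʳ j))
count-split zero    b p = refl
count-split (suc a) b p =
  trans (cong (ind (p zero) +_) (count-split a b (λ i → p (suc i)))) (sym (+-assoc (ind (p zero)) _ _))

count-bijection : ∀ {m k} (f : Fin m → Fin k) (g : Fin k → Fin m) →
  (∀ x → g (f x) ≡ x) → (∀ y → f (g y) ≡ y) → (p : Fin k → Bool) →
  count p ≡ count (λ x → p (f x))
count-bijection f g gf fg p = begin
  count p                         ≡⟨ count-as-sum p ⟩
  sum (λ y → ind (p y))           ≡⟨ sum-permute (λ y → ind (p y)) (permutation f g fg gf) ⟩
  sum (λ x → ind (p (f x)))       ≡⟨ count-as-sum (λ x → p (f x)) ⟨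
  count (λ x → p (f x))           ∎
  where
  open ≡-Reasoning
  open CommutativeMonoidSum +-0-commutativeMonoid using (sum; sum-permute)
  count-as-sum : ∀ {N} (q : Fin N → Bool) → count q ≡ sum (λ i → ind (q i))
  count-as-sum {zero}  q = refl
  count-as-sum {suc N} q = cong (ind (q zero) +_) (count-as-sum (λ i → q (suc i)))

firstIndex : ∀ {m} → (Fin m → Bool) → ℕ
firstIndex {zero}  p = 0
firstIndex {suc m} p = if p zero then 0 else suc (firstIndex (λ i → p (suc i)))

firstIndex-cong : ∀ {m} (p q : Fin m → Bool) → (∀ i → p i ≡ q i) → firstIndex p ≡ firstIndex q
firstIndex-cong {zero}  p q h = refl
firstIndex-cong {suc m} p q h
  rewrite h zero | firstIndex-cong (λ i → p (suc i)) (λ i → q (suc i)) (λ i → h (suc i)) = refl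

firstIndex-attained : ∀ {m} (p : Fin m → Bool) (i : Fin m) → p i ≡ true →
  Σ (Fin m) λ r → toℕ r ≡ firstIndex p × p r ≡ true
firstIndex-attained {suc m} p i pi with p zero in p0
... | true = zero , refl , p0
firstIndex-attained {suc m} p zero    pi | false with trans (sym p0) pi
... | ()
firstIndex-attained {suc m} p (suc i) pi | false with firstIndex-attained (λ j → p (suc j)) i pi
... | r , r-first , pr = suc r , cong suc r-first , pr

firstIndex-min : ∀ {m} (p : Fin m → Bool) (i : Fin m) → p i ≡ true → firstIndex p ≤ toℕ i
firstIndex-min {suc m} p i pi with p zero in p0
... | true = z≤n
firstIndex-min {suc m} p zero    pi | false with trans (sym p0) pi
... | ()
firstIndex-min {suc m} p (suc i) pi | false = s≤s (firstIndex-min (λ j → p (suc j)) i pi)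

record IsEquiv {N} (E : Rel N) : Set where
  field
    reflexive  : ∀ x → E x x ≡ true
    symmetric  : ∀ x y → E x y ≡ true → E y x ≡ true
    transitive : ∀ x y z → E x y ≡ true → E y z ≡ true → E x z ≡ true
open IsEquiv public

Refines : ∀ {N} → Rel N → Rel N → Set
Refines F E = ∀ x y → F x y ≡ true → E x y ≡ true

class-resp : ∀ {N} {E : Rel N} → IsEquiv E → ∀ {a b} w → E a b ≡ true → E a w ≡ E b w
class-resp eq {a} {b} w ab =
  bool-ext (transitive eq b a w (symmetric eq a b ab)) (transitive eq a b w ab)

kernel-equiv : ∀ {N} (c : Fin N → ℕ) → IsEquiv (λ x y → c x ≡ᵇ c y)
kernel-equiv c = record
  { reflexive  = λ x → ≡ᵇ-intro {c x} refl
  ; symmetric  = λ x y e → ≡ᵇ-intro (sym (≡ᵇ-true {c x} {c y} e))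
  ; transitive = λ x y z e₁ e₂ → ≡ᵇ-intro (trans (≡ᵇ-true {c x} {c y} e₁) (≡ᵇ-true {c y} e₂)) }

pullback-equiv : ∀ {m N} {E : Rel N} (f : Fin m → Fin N) → IsEquiv E → IsEquiv (λ x y → E (f x) (f y))
pullback-equiv f eq = record
  { reflexive  = λ x → reflexive eq (f x)
  ; symmetric  = λ x y → symmetric eq (f x) (f y)
  ; transitive = λ x y z → transitive eq (f x) (f y) (f z) }

label : ∀ {N} → Rel N → Fin N → ℕ
label E x = firstIndex (E x)

module _ {N} {E : Rel N} (eq : IsEquiv E) where

  label-attained : ∀ x → Σ (Fin N) λ r → toℕ r ≡ label E x × E x r ≡ true
  label-attained x = firstIndex-attained (E x) x (reflexive eq x)

  label-resp : ∀ x y → E x y ≡ true → label E x ≡ label E y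
  label-resp x y xy = firstIndex-cong (E x) (E y) (λ w → class-resp eq w xy)

  label-reflects : ∀ x y → label E x ≡ label E y → E x y ≡ true
  label-reflects x y same with label-attained x | label-attained y
  ... | r , r-label , xr | r' , r'-label , yr' with toℕ-injective (trans r-label (trans same (sym r'-label)))
  ...   | refl = transitive eq x r y xr (symmetric eq y r yr')

  label-≡ᵇ : ∀ x y → (label E x ≡ᵇ label E y) ≡ E x y
  label-≡ᵇ x y = bool-ext (λ e → label-reflects x y (≡ᵇ-true e)) (λ e → ≡ᵇ-intro (label-resp x y e))

IsRep : ∀ {N} → Rel N → Fin N → Bool
IsRep E x = toℕ x ≡ᵇ label E x

classCount : ∀ {N} → Rel N → ℕ
classCount E = count (IsRep E)

module _ {N} {E : Rel N} (eq : IsEquiv E) where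

  rep-exists : ∀ x → Σ (Fin N) λ r → E x r ≡ true × IsRep E r ≡ true
  rep-exists x with label-attained eq x
  ... | r , r-label , xr = r , xr , ≡ᵇ-intro (trans r-label (label-resp eq x r xr))

  rep-unique : ∀ r r' → IsRep E r ≡ true → IsRep E r' ≡ true → E r r' ≡ true → r ≡ r'
  rep-unique r r' rep rep' rr' =
    toℕ-injective (trans (≡ᵇ-true rep) (trans (label-resp eq r r' rr') (sym (≡ᵇ-true rep'))))

rep-refines : ∀ {N} {E F : Rel N} → IsEquiv E → IsEquiv F → Refines F E →
  ∀ x → IsRep E x ≡ true → IsRep F x ≡ true
rep-refines {E = E} {F} eqE eqF F⊑E x rep with label-attained eqF x
... | r , r-label , xr = ≡ᵇ-intro (≤-antisym x≤F F≤x)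
  where
  F≤x : label F x ≤ toℕ x
  F≤x = firstIndex-min (F x) x (reflexive eqF x)
  x≤F : toℕ x ≤ label F x
  x≤F = subst (_≤ label F x) (sym (≡ᵇ-true rep))
          (subst (label E x ≤_) r-label (firstIndex-min (E x) r (F⊑E x r xr)))

-- A proper refinement has strictly more classes: if F splits x from y, their
-- F-representatives are distinct but E-related, so one of them is not an E-representative.
classCount-strict : ∀ {N} {E F : Rel N} → IsEquiv E → IsEquiv F → Refines F E →
  ∀ x y → E x y ≡ true → F x y ≡ false → suc (classCount E) ≤ classCount F
classCount-strict {E = E} {F} eqE eqF F⊑E x y exy fxy
  with rep-exists eqF x | rep-exists eqF y
... | rx , xrx , rep-rx | ry , yry , rep-ry with IsRep E rx in rx-E
... | false = count-strict _ _ (rep-refines eqE eqF F⊑E) rx rx-E rep-rx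
... | true  = count-strict _ _ (rep-refines eqE eqF F⊑E) ry ry-not-E rep-ry
  where
  rx-E-ry : E rx ry ≡ true
  rx-E-ry = transitive eqE rx x ry (F⊑E rx x (symmetric eqF x rx xrx))
              (transitive eqE x y ry exy (F⊑E y ry yry))
  rx≢ry : rx ≢ ry
  rx≢ry refl with trans (sym (transitive eqF x rx y xrx (symmetric eqF y rx yry))) fxy
  ... | ()
  ry-not-E : IsRep E ry ≡ false
  ry-not-E with IsRep E ry in ry-E
  ... | false = refl
  ... | true  = ⊥-elim (rx≢ry (rep-unique eqE rx ry rx-E ry-E rx-E-ry))

nbCount : ∀ {N} → Rel N → Rel N → Fin N → Fin N → ℕ
nbCount A E u w = count (λ x → A u x ∧ E x w)

module _ {N} (A E : Rel N) where

  refine-true : ∀ u v → refine A E u v ≡ true →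
    E u v ≡ true × (∀ w → nbCount A E u w ≡ nbCount A E v w)
  refine-true u v e with ∧-true {E u v} e
  ... | uv , counts = uv , λ w → ≡ᵇ-true (allFin-true _ counts w)

  refine-intro : ∀ u v → E u v ≡ true → (∀ w → nbCount A E u w ≡ nbCount A E v w) →
    refine A E u v ≡ true
  refine-intro u v uv counts rewrite uv = allFin-intro _ (λ w → ≡ᵇ-intro (counts w))

  refine-refines : Refines (refine A E) E
  refine-refines u v e = proj₁ (refine-true u v e)

  refine-equiv : IsEquiv E → IsEquiv (refine A E)
  refine-equiv eq = record
    { reflexive  = λ x → refine-intro x x (reflexive eq x) (λ w → refl)
    ; symmetric  = λ x y e → let (xy , c) = refine-true x y e in
                   refine-intro y x (symmetric eq x y xy) (λ w → sym (c w))
    ; transitive = λ x y z e₁ e₂ → let (xy , c₁) = refine-true x y e₁ ; (yz , c₂) = refine-true y z e₂ in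
                   refine-intro x z (transitive eq x y z xy yz) (λ w → trans (c₁ w) (c₂ w)) }

Stable : ∀ {N} → Rel N → Rel N → Set
Stable A S = ∀ u v → S u v ≡ true → ∀ w → nbCount A S u w ≡ nbCount A S v w

sameRel-true : ∀ {N} (R E : Rel N) → sameRel R E ≡ true → ∀ x y → R x y ≡ E x y
sameRel-true R E e x y with ∧-true (allFin-true _ e x)
... | R⊆E , E⊆R = bool-ext (implies (allFin-true _ R⊆E y)) (implies (allFin-true _ E⊆R y))
  where
  implies : ∀ {a b} → not a ∨ b ≡ true → a ≡ true → b ≡ true
  implies {true} ab refl = ab

sameRel-false : ∀ {N} (R E : Rel N) → sameRel R E ≡ false → Refines R E →
  Σ (Fin N) λ x → Σ (Fin N) λ y → E x y ≡ true × R x y ≡ false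
sameRel-false R E e R⊑E with allFin-false _ e
... | x , nx with ∧-false nx
...   | inj₁ R⊄E with allFin-false _ R⊄E
...     | y , ny with R x y in rxy
...       | true with trans (sym (R⊑E x y rxy)) ny
...         | ()
sameRel-false R E e R⊑E | x , nx | inj₂ E⊄R with allFin-false _ E⊄R
...     | y , ny with E x y in exy | R x y in rxy
...       | true | false = x , y , exy , rxy

refine-unchanged : ∀ {N} (A E : Rel N) → sameRel (refine A E) E ≡ true → Stable A E
refine-unchanged A E same u v uv =
  proj₂ (refine-true A E u v (trans (sameRel-true (refine A E) E same u v) uv))

refine-grows : ∀ {N} (A E : Rel N) → IsEquiv E → sameRel (refine A E) E ≡ false →
  suc (classCount E) ≤ classCount (refine A E)
refine-grows A E eq changed with sameRel-false _ _ changed (refine-refines A E)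
... | x , y , exy , split =
  classCount-strict eq (refine-equiv A E eq) (refine-refines A E) x y exy split

iterCR-stable : ∀ {N} (A : Rel N) k E → IsEquiv E → N ≤ classCount E + k → Stable A (iterCR k A E)
iterCR-stable {N} A zero E eq enough with sameRel (refine A E) E in same
... | true  = refine-unchanged A E same
... | false = ⊥-elim (n≮n (classCount E) (begin
      suc (classCount E)        ≤⟨ refine-grows A E eq same ⟩
      classCount (refine A E)   ≤⟨ count-≤ _ ⟩
      N                         ≤⟨ enough ⟩
      classCount E + 0          ≡⟨ +-identityʳ _ ⟩
      classCount E              ∎))
  where open Data.Nat.Properties.≤-Reasoning
iterCR-stable {N} A (suc k) E eq enough with sameRel (refine A E) E in same
... | true  = refine-unchanged A E same
... | false = iterCR-stable A k (refine A E) (refine-equiv A E eq) (begin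
      N                                ≤⟨ enough ⟩
      classCount E + suc k             ≡⟨ +-suc (classCount E) k ⟩
      suc (classCount E) + k           ≤⟨ +-monoˡ-≤ k (refine-grows A E eq same) ⟩
      classCount (refine A E) + k      ∎)
  where open Data.Nat.Properties.≤-Reasoning

stableCR-stable : ∀ {N} (A E : Rel N) → IsEquiv E → Stable A (stableCR A E)
stableCR-stable {N} A E eq = iterCR-stable A N E eq (m≤n+m N (classCount E))

iterCR-preserves : ∀ {N} (A : Rel N) (Q : Rel N → Set) → (∀ E → Q E → Q (refine A E)) →
  ∀ k E → Q E → Q (iterCR k A E)
iterCR-preserves A Q step zero    E q = q
iterCR-preserves A Q step (suc k) E q with sameRel (refine A E) E
... | true  = q
... | false = iterCR-preserves A Q step k (refine A E) (step E q)

-- Individualisation.  Merging a marked set M into one fresh class; individualising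
-- a and b is the case M = {a, b}:  individualise E a b = mergeClass (marked a b) E.

mergeClass : ∀ {N} → (Fin N → Bool) → Rel N → Rel N
mergeClass M E x y = (M x ∧ M y) ∨ (not (M x) ∧ not (M y) ∧ E x y)

marked : ∀ {N} → Fin N → Fin N → Fin N → Bool
marked a b x = eqFin x a ∨ eqFin x b

module _ {N} (M : Fin N → Bool) (E : Rel N) where

  mergeClass-equiv : IsEquiv E → IsEquiv (mergeClass M E)
  mergeClass-equiv eq = record { reflexive = refl′ ; symmetric = sym′ ; transitive = trans′ }
    where
    refl′ : ∀ x → mergeClass M E x x ≡ true
    refl′ x with M x
    ... | true  = refl
    ... | false = reflexive eq x
    sym′ : ∀ x y → mergeClass M E x y ≡ true → mergeClass M E y x ≡ true
    sym′ x y e with M x | M y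
    ... | true  | true  = refl
    ... | false | false = symmetric eq x y e
    trans′ : ∀ x y z → mergeClass M E x y ≡ true → mergeClass M E y z ≡ true → mergeClass M E x z ≡ true
    trans′ x y z e₁ e₂ with M x | M y | M z
    ... | true  | true  | true  = refl
    ... | false | false | false = transitive eq x y z e₁ e₂

  mergeClass-refines : (∀ x y → M x ≡ true → M y ≡ true → E x y ≡ true) → Refines (mergeClass M E) E
  mergeClass-refines inside x y e with M x in mx | M y in my
  ... | true  | true  = inside x y mx my
  ... | false | false = e

  mergeClass-unmarked : ∀ x y → M x ≡ false → M y ≡ false → mergeClass M E x y ≡ E x y
  mergeClass-unmarked x y mx my rewrite mx | my = refl

marked-cases : ∀ {N} (a b x : Fin N) → marked a b x ≡ true → x ≡ a ⊎ x ≡ b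
marked-cases a b x e with ∨-true {eqFin x a} e
... | inj₁ xa = inj₁ (eqFin-true xa)
... | inj₂ xb = inj₂ (eqFin-true xb)

marked-others : ∀ {N} {a b x : Fin N} → x ≢ a → x ≢ b → marked a b x ≡ false
marked-others x≢a x≢b rewrite eqFin-≢ x≢a | eqFin-≢ x≢b = refl

individualise-pair : ∀ {N} (E : Rel N) a b → individualise E a b a b ≡ true
individualise-pair E a b rewrite eqFin-refl a | eqFin-refl b | ∨-zeroʳ (eqFin b a) = refl

module _ (G H : Graph) {f : Fin (n G) → Fin (n H)} (iso : IsIso G H f) where

  inverse : Fin (n H) → Fin (n G)
  inverse = proj₁ (proj₁ iso)

  inverse-left : ∀ x → inverse (f x) ≡ x
  inverse-left = proj₁ (proj₂ (proj₁ iso))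

  inverse-right : ∀ y → f (inverse y) ≡ y
  inverse-right = proj₂ (proj₂ (proj₁ iso))

  iso-adj : ∀ a b → adj H (f a) (f b) ≡ adj G a b
  iso-adj = proj₁ (proj₂ iso)

  iso-col : ∀ a → col H (f a) ≡ col G a
  iso-col = proj₂ (proj₂ iso)

  iso-injective : ∀ {x y} → f x ≡ f y → x ≡ y
  iso-injective {x} {y} fx≡fy = trans (sym (inverse-left x)) (trans (cong inverse fx≡fy) (inverse-left y))

  count-along-iso : (p : Fin (n H) → Bool) → count p ≡ count (λ x → p (f x))
  count-along-iso = count-bijection f inverse inverse-left inverse-right

iso-∘ : ∀ {G H K : Graph} {f : Fin (n H) → Fin (n K)} {g : Fin (n G) → Fin (n H)} →
  IsIso H K f → IsIso G H g → IsIso G K (λ x → f (g x))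
iso-∘ {G} {H} {K} {f} {g} isoF isoG =
  ( (λ z → inverse G H isoG (inverse H K isoF z))
  , (λ x → trans (cong (inverse G H isoG) (inverse-left H K isoF (g x))) (inverse-left G H isoG x))
  , (λ z → trans (cong f (inverse-right G H isoG (inverse H K isoF z))) (inverse-right H K isoF z)) )
  , (λ a b → trans (iso-adj H K isoF (g a) (g b)) (iso-adj G H isoG a b))
  , (λ a → trans (iso-col H K isoF (g a)) (iso-col G H isoG a))

module OnUnion (G H : Graph) where
  open Union G H

  inG-injective : ∀ {a b} → inG a ≡ inG b → a ≡ b
  inG-injective {a} {b} = ↑ˡ-injective (n H) a b

  inH-injective : ∀ {a b} → inH a ≡ inH b → a ≡ b
  inH-injective {a} {b} = ↑ʳ-injective (n G) a b

  inG≢inH : ∀ {a b} → inG a ≢ inH b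
  inG≢inH {a} {b} e
    with trans (sym (splitAt-↑ˡ (n G) a (n H))) (trans (cong (splitAt (n G)) e) (splitAt-↑ʳ (n G) (n H) b))
  ... | ()

  adj-GG : ∀ a b → adjU (inG a) (inG b) ≡ adj G a b
  adj-GG a b rewrite splitAt-↑ˡ (n G) a (n H) | splitAt-↑ˡ (n G) b (n H) = refl

  adj-HH : ∀ a b → adjU (inH a) (inH b) ≡ adj H a b
  adj-HH a b rewrite splitAt-↑ʳ (n G) (n H) a | splitAt-↑ʳ (n G) (n H) b = refl

  adj-GH : ∀ a b → adjU (inG a) (inH b) ≡ false
  adj-GH a b rewrite splitAt-↑ˡ (n G) a (n H) | splitAt-↑ʳ (n G) (n H) b = refl

  adj-HG : ∀ a b → adjU (inH a) (inG b) ≡ false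
  adj-HG a b rewrite splitAt-↑ʳ (n G) (n H) a | splitAt-↑ˡ (n G) b (n H) = refl

  col-G : ∀ a → colU (inG a) ≡ col G a
  col-G a rewrite splitAt-↑ˡ (n G) a (n H) = refl

  col-H : ∀ a → colU (inH a) ≡ col H a
  col-H a rewrite splitAt-↑ʳ (n G) (n H) a = refl

  nbCount-G : ∀ (E : Rel N) x w → nbCount adjU E (inG x) w ≡ count (λ a → adj G x a ∧ E (inG a) w)
  nbCount-G E x w = begin
    nbCount adjU E (inG x) w
      ≡⟨ count-split (n G) (n H) _ ⟩
    count (λ a → adjU (inG x) (inG a) ∧ E (inG a) w) + count (λ b → adjU (inG x) (inH b) ∧ E (inH b) w)
      ≡⟨ cong₂ _+_ (count-cong _ _ λ a → cong (_∧ E (inG a) w) (adj-GG x a))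
                   (count-none _ λ b → cong (_∧ E (inH b) w) (adj-GH x b)) ⟩
    count (λ a → adj G x a ∧ E (inG a) w) + 0
      ≡⟨ +-identityʳ _ ⟩
    count (λ a → adj G x a ∧ E (inG a) w) ∎
    where open ≡-Reasoning

  nbCount-H : ∀ (E : Rel N) y w → nbCount adjU E (inH y) w ≡ count (λ b → adj H y b ∧ E (inH b) w)
  nbCount-H E y w =
    trans (count-split (n G) (n H) _)
          (cong₂ _+_ (count-none _ λ a → cong (_∧ E (inG a) w) (adj-HG y a))
                     (count-cong _ _ λ b → cong (_∧ E (inH b) w) (adj-HH y b)))

  Aligned : Rel N → (Fin (n G) → Fin (n H)) → Set
  Aligned E f = ∀ x → E (inG x) (inH (f x)) ≡ true

  record Sound (E : Rel N) : Set where
    field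
      equiv       : IsEquiv E
      refinesInit : Refines E initCol
      aligned     : Iso G H → Σ (Fin (n G) → Fin (n H)) λ f → IsIso G H f × Aligned E f
  open Sound

  sound-init : Sound initCol
  sound-init = record
    { equiv       = kernel-equiv colU
    ; refinesInit = λ x y e → e
    ; aligned     = λ { (f , iso) → f , iso , λ x →
        ≡ᵇ-intro (trans (col-G x) (trans (sym (iso-col G H iso x)) (sym (col-H (f x))))) } }

  -- An aligned isomorphism transports neighbour counts, so stays aligned after refinement.
  aligned-refine : ∀ {E f} → IsEquiv E → IsIso G H f → Aligned E f → Aligned (refine adjU E) f
  aligned-refine {E} {f} eq iso al x = refine-intro adjU E (inG x) (inH (f x)) (al x) counts
    where
    counts : ∀ w → nbCount adjU E (inG x) w ≡ nbCount adjU E (inH (f x)) w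
    counts w = begin
      nbCount adjU E (inG x) w
        ≡⟨ nbCount-G E x w ⟩
      count (λ a → adj G x a ∧ E (inG a) w)
        ≡⟨ count-cong _ _ (λ a → cong₂ _∧_ (sym (iso-adj G H iso x a)) (class-resp eq w (al a))) ⟩
      count (λ a → adj H (f x) (f a) ∧ E (inH (f a)) w)
        ≡⟨ count-along-iso G H iso _ ⟨
      count (λ b → adj H (f x) b ∧ E (inH b) w)
        ≡⟨ nbCount-H E (f x) w ⟨
      nbCount adjU E (inH (f x)) w ∎
      where open ≡-Reasoning

  sound-refine : ∀ E → Sound E → Sound (refine adjU E)
  sound-refine E sd = record
    { equiv       = refine-equiv adjU E (equiv sd)
    ; refinesInit = λ x y e → refinesInit sd x y (refine-refines adjU E x y e)
    ; aligned     = λ i → let (f , iso , al) = aligned sd i in f , iso , aligned-refine (equiv sd) iso al }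

  sound-stable : ∀ {E} → Sound E → Sound (stableCR adjU E)
  sound-stable {E} = iterCR-preserves adjU Sound sound-refine N E

  cellsOnG : Rel N → Fin (n G) → ℕ
  cellsOnG S = label (λ a b → S (inG a) (inG b))

  module _ {S : Rel N} (sd : Sound S) where

    cellsOnG-equiv : IsEquiv (λ a b → S (inG a) (inG b))
    cellsOnG-equiv = pullback-equiv inG (equiv sd)

    cellsOnG-equitable : Stable adjU S → Equitable G (cellsOnG S)
    cellsOnG-equitable stable = monochromatic , equal-counts
      where
      monochromatic : ∀ a b → cellsOnG S a ≡ cellsOnG S b → col G a ≡ col G b
      monochromatic a b same = trans (sym (col-G a)) (trans (≡ᵇ-true same-initial) (col-G b))
        where
        same-initial : initCol (inG a) (inG b) ≡ true
        same-initial = refinesInit sd _ _ (label-reflects cellsOnG-equiv a b same)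
      nbIn-as-nbCount : ∀ a w → nbIn G (cellsOnG S) a (cellsOnG S w) ≡ nbCount adjU S (inG a) (inG w)
      nbIn-as-nbCount a w =
        trans (count-cong _ _ λ x → cong (adj G a x ∧_) (label-≡ᵇ cellsOnG-equiv x w))
              (sym (nbCount-G S a (inG w)))
      equal-counts : ∀ a b w → cellsOnG S a ≡ cellsOnG S b →
        nbIn G (cellsOnG S) a (cellsOnG S w) ≡ nbIn G (cellsOnG S) b (cellsOnG S w)
      equal-counts a b w same =
        trans (nbIn-as-nbCount a w)
          (trans (stable (inG a) (inG b) (label-reflects cellsOnG-equiv a b same) (inG w))
                 (sym (nbIn-as-nbCount b w)))

    realign : Godsil G → Stable adjU S → ∀ {f u v} → IsIso G H f → Aligned S f →
      S (inG u) (inH v) ≡ true → Σ (Fin (n G) → Fin (n H)) λ h → IsIso G H h × Aligned S h × h u ≡ v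
    realign godsil stable {f} {u} {v} iso al uv
      with godsil (cellsOnG S) (cellsOnG-equitable stable)
    ... | Γ , (automorphism , _) , orbits with proj₁ (orbits u (inverse G H iso v)) same-cell
      where
      -- f⁻¹ v has the colour of v, hence of u.
      preimage-aligned : S (inG (inverse G H iso v)) (inH v) ≡ true
      preimage-aligned =
        subst (λ y → S (inG (inverse G H iso v)) (inH y) ≡ true) (inverse-right G H iso v) (al (inverse G H iso v))
      same-cell : cellsOnG S u ≡ cellsOnG S (inverse G H iso v)
      same-cell = label-resp cellsOnG-equiv u (inverse G H iso v)
                    (transitive (equiv sd) _ _ _ uv (symmetric (equiv sd) _ _ preimage-aligned))
    ... | σ , σ∈Γ , σu = (λ x → f (σ x)) , iso-∘ {G} {G} {H} iso (automorphism σ σ∈Γ) , aligned-fσ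
                       , trans (cong f σu) (inverse-right G H iso v)
      where
      aligned-fσ : Aligned S (λ x → f (σ x))
      aligned-fσ x = transitive (equiv sd) _ _ _ x-σx (al (σ x))
        where
        -- x and σ x lie in one orbit, hence in one cell
        x-σx : S (inG x) (inG (σ x)) ≡ true
        x-σx = label-reflects cellsOnG-equiv x (σ x) (proj₂ (orbits x (σ x)) (σ , σ∈Γ , refl))

  aligned-individualise : ∀ {S h u v} → IsIso G H h → Aligned S h → h u ≡ v →
    Aligned (individualise S (inG u) (inH v)) h
  aligned-individualise {S} {h} {u} {v} iso al refl x with x ≟ u
  ... | yes refl = individualise-pair S (inG x) (inH (h x))
  ... | no x≢u = trans (mergeClass-unmarked (marked (inG u) (inH (h u))) S _ _ x-unmarked hx-unmarked) (al x)
    where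
    x-unmarked : marked (inG u) (inH (h u)) (inG x) ≡ false
    x-unmarked = marked-others (λ e → x≢u (inG-injective e)) inG≢inH
    hx-unmarked : marked (inG u) (inH (h u)) (inH (h x)) ≡ false
    hx-unmarked = marked-others (λ e → inG≢inH (sym e)) (λ e → x≢u (iso-injective G H iso (inH-injective e)))

  sound-individualise : Godsil G → ∀ {S} → Sound S → Stable adjU S → ∀ {u v} →
    S (inG u) (inH v) ≡ true → Sound (individualise S (inG u) (inH v))
  sound-individualise godsil {S} sd stable {u} {v} uv = record
    { equiv       = mergeClass-equiv M S (equiv sd)
    ; refinesInit = λ x y e → refinesInit sd x y (mergeClass-refines M S pair-related x y e)
    ; aligned     = λ i → let (f , iso , al) = aligned sd i
                              (h , isoh , alh , hu) = realign sd godsil stable iso al uv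
                          in h , isoh , aligned-individualise {S} isoh alh hu }
    where
    M = marked (inG u) (inH v)
    pair-related : ∀ x y → M x ≡ true → M y ≡ true → S x y ≡ true
    pair-related x y mx my with marked-cases (inG u) (inH v) x mx | marked-cases (inG u) (inH v) y my
    ... | inj₁ refl | inj₁ refl = reflexive (equiv sd) _
    ... | inj₁ refl | inj₂ refl = uv
    ... | inj₂ refl | inj₁ refl = symmetric (equiv sd) _ _ uv
    ... | inj₂ refl | inj₂ refl = reflexive (equiv sd) _

  aligned-sameMultiset : ∀ {S f} → IsEquiv S → IsIso G H f → Aligned S f → SameMultiset S
  aligned-sameMultiset {S} {f} eq iso al w = sym (begin
    cntH S w                           ≡⟨ count-along-iso G H iso _ ⟩
    count (λ x → S (inH (f x)) w)      ≡⟨ count-cong _ _ (λ x → class-resp eq w (al x)) ⟨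
    cntG S w                           ∎)
    where open ≡-Reasoning

  run-correct : Godsil G → ∀ {E a} → Sound E → Run E a → Correct a
  run-correct godsil sd (diffMultiset differ) i with aligned (sound-stable sd) i
  ... | f , iso , al = differ (aligned-sameMultiset (equiv (sound-stable sd)) iso al)
  run-correct godsil sd (discreteYes _ _ (f , _ , iso)) = f , iso
  run-correct godsil sd (discreteNo _ _ noMatch) i with aligned (sound-stable sd) i
  ... | f , iso , al = noMatch (f , al , iso)
  run-correct godsil {E} sd (individ _ _ u v uv _ _ run) =
    run-correct godsil (sound-individualise godsil (sound-stable sd) (stableCR-stable adjU E (equiv sd)) uv) run

lemma9 : (G : Graph) → Godsil G → Tinhofer G
lemma9 G godsil H answer run = OnUnion.run-correct G H godsil (OnUnion.sound-init G H) run
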